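{- Let $\lambda=(\lambda_1\geq\lambda_2\geq\cdots\geq\lambda_n\geq0)$ be a partition with at most $n$ parts. Then $\mathcal{S}_{\mathsf{D}_\lambda}=\mathcal{P}_\lambda\subset\mathbb{R}^n$.
   Context: A diagram $\mathsf{D}$ is a subset of the $n\times n$ grid, $(r,c)$ meaning row $r$ (numbered top to bottom), column $c$. $\mathsf{D}_\lambda$ is the Young diagram of $\lambda$ in French notation placed flush left in the grid, i.e. $\mathsf{D}_\lambda=\{(n-i+1,c):1\leq i\leq n,\ 1\leq c\leq\lambda_i\}$ (row $n$ has $\lambda_1$ boxes). For $S\subseteq[n]$ and column $c$, $\mathtt{word}_{c,S}(\mathsf{D})$ reads rows $1,\ldots,n$ of column $c$ recording "(" if $(r,c)\notin\mathsf{D}$, $r\in S$; ")" if $(r,c)\in\mathsf{D}$, $r\notin S$; "$\star$" if $(r,c)\in\mathsf{D}$, $r\in S$; nothing otherwise. $\theta^c_{\mathsf{D}}(S)$ is the number of matched "()" pairs (usual parenthesis matching, ignoring $\star$) plus the number of $\star$'s, and $\theta_{\mathsf{D}}(S)=\sum_c\theta^c_{\mathsf{D}}(S)$. The Schubitope is $\mathcal{S}_{\mathsf{D}}=\{\alpha\in\mathbb{R}^n_{\geq0}:\sum_i\alpha_i=\#\mathsf{D},\ \sum_{i\in S}\alpha_i\leq\theta_{\mathsf{D}}(S)\text{ for all }S\subseteq[n]\}$. The permutahedron $\mathcal{P}_\lambda$ is the convex hull of the $S_n$-orbit of $\lambda$ in $\mathbb{R}^n$.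
   Formalization: Both sets are taken inside ℚ^n instead of ℝ^n: the points α have rational coordinates, and $\mathcal{P}_\lambda$ is formed from the permutations of λ with rational convex weights. -}

module Defs where

open import Data.Nat using (ℕ; zero; suc; _<ᵇ_)
import Data.Nat as ℕ
open import Data.Bool using (Bool; true; false; if_then_else_; _∧_; not)
open import Data.Fin using (Fin; zero; suc; toℕ; opposite)
open import Data.Fin.Subset using (Subset)
open import Data.Fin.Permutation using (Permutation′; _⟨$⟩ʳ_)
open import Data.Vec using (lookup)
open import Data.List using (List; []; _∷_; map; foldr)
open import Data.List.Relation.Unary.All using (All)
open import Data.Product using (_×_; _,_; proj₁; ∃)
open import Data.Integer using (+_)
open import Data.Rational using (ℚ; 0ℚ; 1ℚ; _+_; _*_; _≤_; _/_)
open import Relation.Binary.PropositionalEquality using (_≡_)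

Σℕ : ∀ {n} → (Fin n → ℕ) → ℕ
Σℕ {zero}  f = 0
Σℕ {suc n} f = f zero ℕ.+ Σℕ (λ i → f (suc i))

Σℚ : ∀ {n} → (Fin n → ℚ) → ℚ
Σℚ {zero}  f = 0ℚ
Σℚ {suc n} f = f zero + Σℚ (λ i → f (suc i))

ι : ℕ → ℚ
ι k = + k / 1

-- Diagrams: subsets of the grid [n] × [m]; row index 0 is the top row
-- (row 1 of the paper), column index 0 is column 1 of the paper.

Diagram : ℕ → ℕ → Set
Diagram n m = Fin n → Fin m → Bool

size : ∀ {n m} → Diagram n m → ℕ
size D = Σℕ (λ r → Σℕ (λ c → if D r c then 1 else 0))

-- Young diagram of λ (λ i = λ_{i+1}) in French notation, flush left:
-- (row r, column c) (1-based) ∈ D_λ iff r = n-i+1, c ≤ λ_i.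
-- With 0-based indices: row r' ↦ part index opposite r' = n-1-r'.
youngDiagram : ∀ {n} m → (Fin n → ℕ) → Diagram n m
youngDiagram m lam r c = toℕ c <ᵇ lam (opposite r)

data Symbol : Set where
  open′ close′ star : Symbol

word : ∀ {n m} → Diagram n m → Fin m → Subset n → List Symbol
word {zero}  D c S = []
word {suc n} D c S = sym (D zero c) (lookup S zero)
  (word (λ r → D (suc r)) c (Data.Vec.tail S))
  where
  sym : Bool → Bool → List Symbol → List Symbol
  sym false true  w = open′ ∷ w
  sym true  false w = close′ ∷ w
  sym true  true  w = star ∷ w
  sym false false w = w

-- number of matched "()" pairs plus number of stars;
-- first argument = number of currently unmatched "("
θw : ℕ → List Symbol → ℕ
θw k []            = 0
θw k (open′ ∷ w)   = θw (suc k) w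
θw zero (close′ ∷ w)    = θw zero w
θw (suc k) (close′ ∷ w) = suc (θw k w)
θw k (star ∷ w)    = suc (θw k w)

θcol : ∀ {n m} → Diagram n m → Fin m → Subset n → ℕ
θcol D c S = θw 0 (word D c S)

θ : ∀ {n m} → Diagram n m → Subset n → ℕ
θ D S = Σℕ (λ c → θcol D c S)

Σ_over : ∀ {n} → Subset n → (Fin n → ℚ) → ℚ
Σ_over S α = Σℚ (λ i → if lookup S i then α i else 0ℚ)

InSchubitope : ∀ {n m} → Diagram n m → (Fin n → ℚ) → Set
InSchubitope D α =
  (∀ i → 0ℚ ≤ α i) ×
  (Σℚ α ≡ ι (size D)) ×
  (∀ (S : Subset _) → Σ_over S α ≤ ι (θ D S))

-- Permutahedron (rational points): convex combinations (rational weights)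
-- of the points (λ_{σ(1)},…,λ_{σ(n)}), σ ∈ S_n.

InPermutahedron : ∀ {n} → (Fin n → ℕ) → (Fin n → ℚ) → Set
InPermutahedron {n} lam α =
  ∃ λ (ws : List (ℚ × Permutation′ n)) →
    All (λ p → 0ℚ ≤ proj₁ p) ws ×
    (foldr (λ p s → proj₁ p + s) 0ℚ ws ≡ 1ℚ) ×
    (∀ i → α i ≡ foldr (λ { (w , σ) s → w * ι (lam (σ ⟨$⟩ʳ i)) + s }) 0ℚ ws)

IsPartition : ∀ {n} → (Fin n → ℕ) → Set
IsPartition lam = ∀ i j → toℕ i ℕ.≤ toℕ j → lam j ℕ.≤ lam i

{-# OPTIONS --safe #-}
-- Both polytopes are the set of nonnegative α majorized by λ.
--
-- Schubitope: each column word of D_λ is a run of "(" followed by ")" and "⋆",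
-- so θ(S) = Σ_c min(|S|, λ'_c), which by double counting is λ₁ + ⋯ + λ_|S|.
--
-- Permutahedron (Rado): permutations of λ are majorized by λ, and majorization
-- survives convex combinations.  Conversely, for α ≺ λ take a largest entry α_p
-- and the first k with λ_k ≤ α_p, write α_p = t λ₁ + (1 - t) λ_k, and let
-- z = t λ + (1 - t) μ, where μ is λ with λ_k moved to the front.  Then z₁ = α_p,
-- and the rest of z is decreasing and majorizes α with α_p deleted; by induction
-- α lies in the hull of the permutations of z, hence of λ.
module Submission where

open import Defs
open import Algebra.Bundles using (Ring)
import Algebra.Properties.Group as GroupProperties
import Algebra.Properties.Semiring.Sum as SemiringSum
open import Data.Bool using (Bool; true; false; if_then_else_; _∧_; T)
import Data.Bool.Properties as BoolP
open import Data.Empty using (⊥-elim)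
open import Data.Fin using (Fin; zero; suc; toℕ; opposite; punchIn; punchOut; inject; fromℕ<; _≟_)
import Data.Fin.Properties as FinP
open import Data.Fin.Permutation
  using (Permutation′; _⟨$⟩ʳ_; _⟨$⟩ˡ_; _∘ₚ_; id; insert; insert-punchIn; inverseˡ; reverse)
open import Data.Fin.Subset using (Subset)
import Data.Integer as ℤ
import Data.Integer.Properties as ℤP
open import Data.List using (List; []; _∷_; foldr; map; allFin)
import Data.List.Extrema
open import Data.List.Membership.Propositional.Properties using (∈-allFin)
open import Data.List.Properties using (foldr-map)
open import Data.List.Relation.Unary.All as All using (All; []; _∷_)
import Data.List.Relation.Unary.All.Properties as AllP
import Data.Nat as ℕ
open import Data.Nat using (ℕ; zero; suc; _<ᵇ_; z≤n; s≤s)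
import Data.Nat.Coprimality as Coprime
import Data.Nat.Properties as ℕP
open import Data.Product using (_×_; _,_; proj₁; proj₂; ∃)
open import Data.Rational
  using (ℚ; 0ℚ; 1ℚ; _+_; _*_; _-_; -_; _/_; 1/_; _≤_; _<_; *≤*; mkℚ; Positive; NonZero; positive; nonNegative)
import Data.Rational.Properties as ℚP
open import Data.Rational.Solver using (module +-*-Solver)
open import Data.Unit using (tt)
open import Data.Vec using ([]; _∷_; lookup; tabulate)
open import Data.Vec.Properties using (lookup∘tabulate)
open import Data.Vec.Functional using (insertAt; removeAt; tail)
open import Data.Vec.Functional.Properties using (insertAt-lookup; insertAt-punchIn; removeAt-punchOut)
open import Function using (_∘_; Equivalence)
open import Relation.Binary.PropositionalEquality
open import Relation.Binary.Bundles using (DecTotalOrder)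
open import Relation.Nullary using (¬_; Dec; yes; no)

open +-*-Solver using (solve; _:+_; _:*_; _:-_; :-_; _:=_; con)

module ℚ∑ = SemiringSum (Ring.semiring ℚP.+-*-ring)
module ℕ∑ = SemiringSum ℕP.+-*-semiring

ι≡mkℚ : ∀ k → ι k ≡ mkℚ (ℤ.+ k) 0 (Coprime.sym (Coprime.1-coprimeTo k))
ι≡mkℚ k = ℚP.normalize-coprime _

ι-+ : ∀ a b → ι (a ℕ.+ b) ≡ ι a + ι b
ι-+ a b rewrite ι≡mkℚ a | ι≡mkℚ b =
  cong (_/ 1) (sym (cong₂ ℤ._+_ (ℤP.*-identityʳ (ℤ.+ a)) (ℤP.*-identityʳ (ℤ.+ b))))

ι-mono : ∀ {a b} → a ℕ.≤ b → ι a ≤ ι b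
ι-mono {a} {b} a≤b rewrite ι≡mkℚ a | ι≡mkℚ b =
  *≤* (subst₂ ℤ._≤_ (sym (ℤP.*-identityʳ (ℤ.+ a))) (sym (ℤP.*-identityʳ (ℤ.+ b))) (ℤ.+≤+ a≤b))

ι-nonNeg : ∀ k → 0ℚ ≤ ι k
ι-nonNeg k = ι-mono {0} {k} z≤n

ι-if : ∀ (b : Bool) k → ι (if b then k else 0) ≡ (if b then ι k else 0ℚ)
ι-if true  k = refl
ι-if false k = refl

0≤1 : 0ℚ ≤ 1ℚ
0≤1 = ℚP.nonNegative⁻¹ 1ℚ

p≤q⇒0≤q-p : ∀ {p q} → p ≤ q → 0ℚ ≤ q - p
p≤q⇒0≤q-p {p} {q} p≤q = subst (_≤ q - p) (ℚP.+-inverseʳ p) (ℚP.+-monoˡ-≤ (- p) p≤q)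

p<q⇒0<q-p : ∀ {p q} → p < q → 0ℚ < q - p
p<q⇒0<q-p {p} {q} p<q = subst (_< q - p) (ℚP.+-inverseʳ p) (ℚP.+-monoˡ-< (- p) p<q)

*-nonNeg : ∀ {p q} → 0ℚ ≤ p → 0ℚ ≤ q → 0ℚ ≤ p * q
*-nonNeg {p} {q} 0≤p 0≤q =
  ℚP.nonNegative⁻¹ (p * q) {{ℚP.nonNeg*nonNeg⇒nonNeg p {{nonNegative 0≤p}} q {{nonNegative 0≤q}}}}

*-monoˡ-≤-nonNeg : ∀ {r p q} → 0ℚ ≤ r → p ≤ q → r * p ≤ r * q
*-monoˡ-≤-nonNeg {r} 0≤r = ℚP.*-monoˡ-≤-nonNeg r {{nonNegative 0≤r}}

+-cancelˡ : ∀ p {q r} → p + q ≡ p + r → q ≡ r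
+-cancelˡ p = GroupProperties.∙-cancelˡ ℚP.+-0-group p _ _

+-cancelˡ-≤ : ∀ p {q r} → p + q ≤ p + r → q ≤ r
+-cancelˡ-≤ p {q} {r} p+q≤p+r = subst₂ _≤_ (-p+[p+x]≡x q) (-p+[p+x]≡x r) (ℚP.+-monoʳ-≤ (- p) p+q≤p+r)
  where
  -p+[p+x]≡x : ∀ x → - p + (p + x) ≡ x
  -p+[p+x]≡x = solve 2 (λ p x → (:- p) :+ (p :+ x) := x) refl p

mix : ℚ → ℚ → ℚ → ℚ
mix t a b = t * a + (1ℚ - t) * b

mix-idem : ∀ t a → mix t a a ≡ a
mix-idem = solve 2 (λ t a → t :* a :+ (con 1ℚ :- t) :* a := a) refl

mix-mono : ∀ {t a b c d} → 0ℚ ≤ t → t ≤ 1ℚ → a ≤ c → b ≤ d → mix t a b ≤ mix t c d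
mix-mono 0≤t t≤1 a≤c b≤d =
  ℚP.+-mono-≤ (*-monoˡ-≤-nonNeg 0≤t a≤c) (*-monoˡ-≤-nonNeg (p≤q⇒0≤q-p t≤1) b≤d)

between⇒mix : ∀ {a b c} → a ≤ c → c ≤ b → ∃ λ t → 0ℚ ≤ t × t ≤ 1ℚ × mix t b a ≡ c
between⇒mix {a} {b} {c} a≤c c≤b with a ℚP.<? b
... | no a≮b = 0ℚ , ℚP.≤-refl , 0≤1 ,
  trans (solve 2 (λ b a → con 0ℚ :* b :+ (con 1ℚ :- con 0ℚ) :* a := a) refl b a)
        (ℚP.≤-antisym a≤c (ℚP.≤-trans c≤b (ℚP.≮⇒≥ a≮b)))
... | yes a<b = t , 0≤t , t≤1 , mix≡c
  where
  instance
    b-a>0 : Positive (b - a)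
    b-a>0 = positive (p<q⇒0<q-p a<b)
    b-a≢0 : NonZero (b - a)
    b-a≢0 = ℚP.pos⇒nonZero (b - a)
  t = (c - a) * 1/ (b - a)
  t*[b-a]≡c-a : t * (b - a) ≡ c - a
  t*[b-a]≡c-a = begin
    (c - a) * 1/ (b - a) * (b - a)   ≡⟨ ℚP.*-assoc (c - a) _ _ ⟩
    (c - a) * (1/ (b - a) * (b - a)) ≡⟨ cong ((c - a) *_) (ℚP.*-inverseˡ (b - a)) ⟩
    (c - a) * 1ℚ                     ≡⟨ ℚP.*-identityʳ (c - a) ⟩
    c - a                            ∎
    where open ≡-Reasoning
  0≤t : 0ℚ ≤ t
  0≤t = *-nonNeg (p≤q⇒0≤q-p a≤c) (ℚP.<⇒≤ (ℚP.positive⁻¹ _ {{ℚP.1/pos⇒pos (b - a)}}))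
  t≤1 : t ≤ 1ℚ
  t≤1 = ℚP.*-cancelʳ-≤-pos (b - a)
    (subst₂ _≤_ (sym t*[b-a]≡c-a) (sym (ℚP.*-identityˡ (b - a))) (ℚP.+-monoˡ-≤ (- a) c≤b))
  mix≡c : mix t b a ≡ c
  mix≡c = begin
    mix t b a
      ≡⟨ solve 3 (λ t b a → t :* b :+ (con 1ℚ :- t) :* a := a :+ t :* (b :- a)) refl t b a ⟩
    a + t * (b - a)
      ≡⟨ cong (a +_) t*[b-a]≡c-a ⟩
    a + (c - a)
      ≡⟨ solve 2 (λ a c → a :+ (c :- a) := c) refl a c ⟩
    c ∎
    where open ≡-Reasoning

Σℕ≗sum : ∀ {n} (f : Fin n → ℕ) → Σℕ f ≡ ℕ∑.sum f
Σℕ≗sum {zero}  f = refl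
Σℕ≗sum {suc n} f = cong (f zero ℕ.+_) (Σℕ≗sum (f ∘ suc))

Σℚ≗sum : ∀ {n} (f : Fin n → ℚ) → Σℚ f ≡ ℚ∑.sum f
Σℚ≗sum {zero}  f = refl
Σℚ≗sum {suc n} f = cong (f zero +_) (Σℚ≗sum (f ∘ suc))

ι-sum : ∀ {n} (f : Fin n → ℕ) → ι (ℕ∑.sum f) ≡ ℚ∑.sum (ι ∘ f)
ι-sum {zero}  f = refl
ι-sum {suc n} f = trans (ι-+ (f zero) _) (cong (ι (f zero) +_) (ι-sum (f ∘ suc)))

sum-mono-≤ : ∀ {n} {f g : Fin n → ℚ} → (∀ i → f i ≤ g i) → ℚ∑.sum f ≤ ℚ∑.sum g
sum-mono-≤ {zero}  f≤g = ℚP.≤-refl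
sum-mono-≤ {suc n} f≤g = ℚP.+-mono-≤ (f≤g zero) (sum-mono-≤ (f≤g ∘ suc))

sum-mono-< : ∀ {n} {f g : Fin (suc n) → ℚ} → (∀ i → f i < g i) → ℚ∑.sum f < ℚ∑.sum g
sum-mono-< f<g = ℚP.+-mono-<-≤ (f<g zero) (sum-mono-≤ (ℚP.<⇒≤ ∘ f<g ∘ suc))

sum-mix : ∀ {n} t (f g : Fin n → ℚ) → ℚ∑.sum (λ i → mix t (f i) (g i)) ≡ mix t (ℚ∑.sum f) (ℚ∑.sum g)
sum-mix t f g = trans (ℚ∑.∑-distrib-+ (λ i → t * f i) (λ i → (1ℚ - t) * g i))
  (sym (cong₂ _+_ (ℚ∑.*-distribˡ-sum t f) (ℚ∑.*-distribˡ-sum (1ℚ - t) g)))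

count : ∀ {n} → (Fin n → Bool) → ℕ
count P = ℕ∑.sum (λ i → if P i then 1 else 0)

count-cong : ∀ {n} {P Q : Fin n → Bool} → (∀ i → P i ≡ Q i) → count P ≡ count Q
count-cong P≗Q = ℕ∑.sum-cong-≗ (λ i → cong (λ b → if b then 1 else 0) (P≗Q i))

count-≤ : ∀ {n} (P : Fin n → Bool) → count P ℕ.≤ n
count-≤ {zero}  P = z≤n
count-≤ {suc n} P with P zero
... | true  = s≤s (count-≤ (P ∘ suc))
... | false = ℕP.m≤n⇒m≤1+n (count-≤ (P ∘ suc))

count-all : ∀ {n} (P : Fin n → Bool) → (∀ i → T (P i)) → count P ≡ n
count-all {zero}  P _     = refl
count-all {suc n} P all-P with P zero | all-P zero
... | true  | _  = cong suc (count-all (P ∘ suc) (all-P ∘ suc))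
... | false | ()

count-permute : ∀ {n} (P : Fin n → Bool) (π : Permutation′ n) → count (P ∘ (π ⟨$⟩ʳ_)) ≡ count P
count-permute P π = sym (ℕ∑.sum-permute _ π)

count-insert : ∀ {n} (P : Fin n → Bool) p → count (insertAt P p true) ≡ suc (count P)
count-insert P p = trans (ℕ∑.sum-remove {i = p} (λ i → if insertAt P p true i then 1 else 0))
  (cong₂ ℕ._+_ (cong (λ b → if b then 1 else 0) (insertAt-lookup P p true))
               (count-cong (insertAt-punchIn P p true)))

prefix : ∀ {n} → ℕ → Fin n → Bool
prefix s i = toℕ i <ᵇ s

count-prefix : ∀ n s → count (prefix {n} s) ≡ s ℕ.⊓ n
count-prefix zero    s       = sym (ℕP.⊓-zeroʳ s)
count-prefix (suc n) zero    = ℕ∑.sum-replicate-zero n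
count-prefix (suc n) (suc s) = cong suc (count-prefix n s)

<ᵇ-⊓ : ∀ x a b → ((x <ᵇ a) ∧ (x <ᵇ b)) ≡ (x <ᵇ a ℕ.⊓ b)
<ᵇ-⊓ x       zero    b       = refl
<ᵇ-⊓ x       (suc a) zero    = BoolP.∧-zeroʳ (x <ᵇ suc a)
<ᵇ-⊓ zero    (suc a) (suc b) = refl
<ᵇ-⊓ (suc x) (suc a) (suc b) = <ᵇ-⊓ x a b

prefix-punchIn : ∀ {n} (k : Fin (suc n)) i {s} → toℕ k ℕ.≤ s → prefix (suc s) (punchIn k i) ≡ prefix s i
prefix-punchIn zero    i       _         = refl
prefix-punchIn (suc k) zero    (s≤s _)   = refl
prefix-punchIn (suc k) (suc i) (s≤s k≤s) = prefix-punchIn k i k≤s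

DownClosed : ∀ {n} → (Fin n → Bool) → Set
DownClosed P = ∀ i j → toℕ i ℕ.≤ toℕ j → T (P j) → T (P i)

UpClosed : ∀ {n} → (Fin n → Bool) → Set
UpClosed P = ∀ i j → toℕ i ℕ.≤ toℕ j → T (P i) → T (P j)

upClosed-tail : ∀ {n} {P : Fin (suc n) → Bool} → UpClosed P → UpClosed (P ∘ suc)
upClosed-tail up i j i≤j = up (suc i) (suc j) (s≤s i≤j)

downClosed-tail : ∀ {n} {P : Fin (suc n) → Bool} → DownClosed P → DownClosed (P ∘ suc)
downClosed-tail down i j i≤j = down (suc i) (suc j) (s≤s i≤j)

downClosed⇒prefix : ∀ {n} {P : Fin n → Bool} → DownClosed P → ∀ i → P i ≡ prefix (count P) i
downClosed⇒prefix {suc n} {P} down i with P zero in P₀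
... | true = head-true i
  where
  head-true : ∀ i → P i ≡ prefix (suc (count (P ∘ suc))) i
  head-true zero    = P₀
  head-true (suc i) = downClosed⇒prefix (downClosed-tail down) i
... | false = trans (none i) (sym (cong (λ c → prefix c i) count-tail≡0))
  where
  none : ∀ j → P j ≡ false
  none j with P j | down zero j z≤n
  ... | false | _    = refl
  ... | true  | P⇒P₀ = ⊥-elim (subst T P₀ (P⇒P₀ tt))
  count-tail≡0 : count (P ∘ suc) ≡ 0
  count-tail≡0 = trans (count-cong (none ∘ suc)) (ℕ∑.sum-replicate-zero n)

sumOver : ∀ {n} → (Fin n → Bool) → (Fin n → ℚ) → ℚ
sumOver S x = ℚ∑.sum (λ i → if S i then x i else 0ℚ)

topSum : ∀ {n} → ℕ → (Fin n → ℚ) → ℚ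
topSum s = sumOver (prefix s)

sumOver-cong : ∀ {n} (S : Fin n → Bool) {x y : Fin n → ℚ} → (∀ i → x i ≡ y i) → sumOver S x ≡ sumOver S y
sumOver-cong S x≗y = ℚ∑.sum-cong-≗ (λ i → cong (λ u → if S i then u else 0ℚ) (x≗y i))

sumOver-congˡ : ∀ {n} {S R : Fin n → Bool} (x : Fin n → ℚ) → (∀ i → S i ≡ R i) → sumOver S x ≡ sumOver R x
sumOver-congˡ x S≗R = ℚ∑.sum-cong-≗ (λ i → cong (λ b → if b then x i else 0ℚ) (S≗R i))

sumOver-mono : ∀ {n} (S : Fin n → Bool) {x y : Fin n → ℚ} → (∀ i → T (S i) → x i ≤ y i) →
  sumOver S x ≤ sumOver S y
sumOver-mono S {x} {y} x≤y = sum-mono-≤ pointwise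
  where
  pointwise : ∀ i → (if S i then x i else 0ℚ) ≤ (if S i then y i else 0ℚ)
  pointwise i with S i | x≤y i
  ... | true  | x≤yᵢ = x≤yᵢ tt
  ... | false | _    = ℚP.≤-refl

sumOver-mix : ∀ {n} (S : Fin n → Bool) t (x y : Fin n → ℚ) →
  sumOver S (λ i → mix t (x i) (y i)) ≡ mix t (sumOver S x) (sumOver S y)
sumOver-mix S t x y = trans (ℚ∑.sum-cong-≗ pointwise)
  (sum-mix t (λ i → if S i then x i else 0ℚ) (λ i → if S i then y i else 0ℚ))
  where
  pointwise : ∀ i → (if S i then mix t (x i) (y i) else 0ℚ) ≡
                    mix t (if S i then x i else 0ℚ) (if S i then y i else 0ℚ)
  pointwise i with S i
  ... | true  = refl
  ... | false = sym (mix-idem t 0ℚ)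

sumOver-const : ∀ {n} (S : Fin n → Bool) c → sumOver S (λ _ → c) ≡ ι (count S) * c
sumOver-const S c = begin
  sumOver S (λ _ → c)                          ≡⟨ ℚ∑.sum-cong-≗ pointwise ⟩
  ℚ∑.sum (λ i → ι (if S i then 1 else 0) * c)  ≡⟨ ℚ∑.*-distribʳ-sum c (ι ∘ indicator) ⟨
  ℚ∑.sum (λ i → ι (if S i then 1 else 0)) * c  ≡⟨ cong (_* c) (ι-sum indicator) ⟨
  ι (count S) * c                              ∎
  where
  open ≡-Reasoning
  indicator : Fin _ → ℕ
  indicator i = if S i then 1 else 0
  pointwise : ∀ i → (if S i then c else 0ℚ) ≡ ι (if S i then 1 else 0) * c
  pointwise i with S i
  ... | true  = sym (ℚP.*-identityˡ c)
  ... | false = sym (ℚP.*-zeroˡ c)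

sumOver-insert : ∀ {n} (S : Fin n → Bool) p (x : Fin (suc n) → ℚ) →
  sumOver (insertAt S p true) x ≡ x p + sumOver S (removeAt x p)
sumOver-insert S p x = trans (ℚ∑.sum-remove {i = p} (λ i → if insertAt S p true i then x i else 0ℚ))
  (cong₂ _+_ (cong (λ b → if b then x p else 0ℚ) (insertAt-lookup S p true))
             (sumOver-congˡ (removeAt x p) (insertAt-punchIn S p true)))

topSum-const : ∀ {n} s c → s ℕ.≤ n → topSum {n} s (λ _ → c) ≡ ι s * c
topSum-const {n} s c s≤n = trans (sumOver-const (prefix {n} s) c)
  (cong (λ k → ι k * c) (trans (count-prefix n s) (ℕP.m≤n⇒m⊓n≡m s≤n)))

topSum-remove : ∀ {n} (y : Fin (suc n) → ℚ) k {s} → toℕ k ℕ.≤ s →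
  topSum (suc s) y ≡ y k + topSum s (removeAt y k)
topSum-remove y k {s} k≤s = trans (ℚ∑.sum-remove {i = k} (λ i → if prefix (suc s) i then y i else 0ℚ))
  (cong₂ _+_ (cong (λ b → if b then y k else 0ℚ) (Equivalence.to BoolP.T-≡ (ℕP.<⇒<ᵇ (s≤s k≤s))))
             (sumOver-congˡ (removeAt y k) (λ i → prefix-punchIn k i k≤s)))

Decreasing : ∀ {n} → (Fin n → ℚ) → Set
Decreasing y = ∀ i j → toℕ i ℕ.≤ toℕ j → y j ≤ y i

-- For decreasing y this is majorization; quantifying over all subsets S
-- replaces sorting x.
record _≺_ {n} (x y : Fin n → ℚ) : Set where
  constructor majorization
  field
    sum-≡     : ℚ∑.sum x ≡ ℚ∑.sum y
    sumOver-≤ : ∀ S → sumOver S x ≤ topSum (count S) y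

open _≺_

decreasing-tail : ∀ {n} {y : Fin (suc n) → ℚ} → Decreasing y → Decreasing (y ∘ suc)
decreasing-tail y↓ i j i≤j = y↓ (suc i) (suc j) (s≤s i≤j)

topSum-tail : ∀ {n} {y : Fin (suc n) → ℚ} → Decreasing y → ∀ {s} → s ℕ.≤ n → topSum s (y ∘ suc) ≤ topSum s y
topSum-tail {n}     y↓ {zero}  _         =
  ℚP.≤-reflexive (trans (ℚ∑.sum-replicate-zero n) (sym (ℚ∑.sum-replicate-zero (suc n))))
topSum-tail {suc n} y↓ {suc s} (s≤s s≤n) =
  ℚP.+-mono-≤ (y↓ zero (suc zero) z≤n) (topSum-tail (decreasing-tail y↓) s≤n)

sumOver≤topSum : ∀ {n} {y : Fin n → ℚ} → Decreasing y → ∀ S → sumOver S y ≤ topSum (count S) y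
sumOver≤topSum {zero}      y↓ S = ℚP.≤-refl
sumOver≤topSum {suc n} {y} y↓ S with S zero
... | true  = ℚP.+-monoʳ-≤ (y zero) (sumOver≤topSum (decreasing-tail y↓) (S ∘ suc))
... | false = subst (_≤ topSum (count (S ∘ suc)) y) (sym (ℚP.+-identityˡ _))
  (ℚP.≤-trans (sumOver≤topSum (decreasing-tail y↓) (S ∘ suc)) (topSum-tail y↓ (count-≤ (S ∘ suc))))

permute-≺ : ∀ {n} {y : Fin n → ℚ} → Decreasing y → (σ : Permutation′ n) → (y ∘ (σ ⟨$⟩ʳ_)) ≺ y
permute-≺ {y = y} y↓ σ = majorization (sym (ℚ∑.sum-permute y σ)) bound
  where
  bound : ∀ S → sumOver S (y ∘ (σ ⟨$⟩ʳ_)) ≤ topSum (count S) y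
  bound S = subst₂ _≤_ sumOver-Sσ (cong (λ k → topSum k y) count-Sσ) (sumOver≤topSum y↓ Sσ)
    where
    Sσ : Fin _ → Bool
    Sσ = S ∘ (σ ⟨$⟩ˡ_)
    sumOver-Sσ : sumOver Sσ y ≡ sumOver S (y ∘ (σ ⟨$⟩ʳ_))
    sumOver-Sσ = trans (ℚ∑.sum-permute (λ j → if Sσ j then y j else 0ℚ) σ)
      (sumOver-congˡ (y ∘ (σ ⟨$⟩ʳ_)) (λ i → cong S (inverseˡ σ {i})))
    count-Sσ : count Sσ ≡ count S
    count-Sσ = trans (sym (count-permute Sσ σ)) (count-cong (λ i → cong S (inverseˡ σ {i})))

Combination : ℕ → Set
Combination n = List (ℚ × Permutation′ n)

weightSum : ∀ {n} → Combination n → ℚ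
weightSum = foldr (λ p s → proj₁ p + s) 0ℚ

combine : ∀ {n} → Combination n → (Permutation′ n → ℚ) → ℚ
combine ws f = foldr (λ p s → proj₁ p * f (proj₂ p) + s) 0ℚ ws

NonNegWeights : ∀ {n} → Combination n → Set
NonNegWeights = All (λ p → 0ℚ ≤ proj₁ p)

InPermutationHull : ∀ {n} → (Fin n → ℚ) → (Fin n → ℚ) → Set
InPermutationHull {n} y x = ∃ λ (ws : Combination n) →
  NonNegWeights ws × weightSum ws ≡ 1ℚ × (∀ i → x i ≡ combine ws (λ σ → y (σ ⟨$⟩ʳ i)))

combine-cong : ∀ {n} (ws : Combination n) {f g} → (∀ σ → f σ ≡ g σ) → combine ws f ≡ combine ws g
combine-cong []             f≗g = refl
combine-cong ((w , σ) ∷ ws) f≗g = cong₂ (λ u v → w * u + v) (f≗g σ) (combine-cong ws f≗g)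

combine-const : ∀ {n} (ws : Combination n) c → combine ws (λ _ → c) ≡ weightSum ws * c
combine-const []             c = sym (ℚP.*-zeroˡ c)
combine-const ((w , σ) ∷ ws) c =
  trans (cong (w * c +_) (combine-const ws c)) (sym (ℚP.*-distribʳ-+ c w (weightSum ws)))

combine-zero : ∀ {n} (ws : Combination n) → combine ws (λ _ → 0ℚ) ≡ 0ℚ
combine-zero ws = trans (combine-const ws 0ℚ) (ℚP.*-zeroʳ (weightSum ws))

combine-average : ∀ {n} (ws : Combination n) → weightSum ws ≡ 1ℚ → ∀ c → combine ws (λ _ → c) ≡ c
combine-average ws Σw≡1 c =
  trans (combine-const ws c) (trans (cong (_* c) Σw≡1) (ℚP.*-identityˡ c))

combine-mono : ∀ {n} {ws : Combination n} → NonNegWeights ws → ∀ {f g} → (∀ σ → f σ ≤ g σ) →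
  combine ws f ≤ combine ws g
combine-mono []          f≤g = ℚP.≤-refl
combine-mono (w≥0 ∷ ws≥0) f≤g = ℚP.+-mono-≤ (*-monoˡ-≤-nonNeg w≥0 (f≤g _)) (combine-mono ws≥0 f≤g)

sum-combine : ∀ {n m} (ws : Combination n) (v : Permutation′ n → Fin m → ℚ) →
  ℚ∑.sum (λ i → combine ws (λ σ → v σ i)) ≡ combine ws (λ σ → ℚ∑.sum (v σ))
sum-combine {m = m} []             v = ℚ∑.sum-replicate-zero m
sum-combine         ((w , σ) ∷ ws) v = begin
  ℚ∑.sum (λ i → w * v σ i + combine ws (λ τ → v τ i))
    ≡⟨ ℚ∑.∑-distrib-+ (λ i → w * v σ i) _ ⟩
  ℚ∑.sum (λ i → w * v σ i) + ℚ∑.sum (λ i → combine ws (λ τ → v τ i))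
    ≡⟨ cong₂ _+_ (ℚ∑.*-distribˡ-sum w (v σ)) (sym (sum-combine ws v)) ⟨
  w * ℚ∑.sum (v σ) + combine ws (λ τ → ℚ∑.sum (v τ)) ∎
  where open ≡-Reasoning

sumOver-combine : ∀ {n m} (ws : Combination n) (S : Fin m → Bool) (v : Permutation′ n → Fin m → ℚ) →
  sumOver S (λ i → combine ws (λ σ → v σ i)) ≡ combine ws (λ σ → sumOver S (v σ))
sumOver-combine ws S v = trans (ℚ∑.sum-cong-≗ pointwise) (sum-combine ws (λ σ i → if S i then v σ i else 0ℚ))
  where
  pointwise : ∀ i → (if S i then combine ws (λ σ → v σ i) else 0ℚ) ≡
                    combine ws (λ σ → if S i then v σ i else 0ℚ)
  pointwise i with S i
  ... | true  = refl
  ... | false = sym (combine-zero ws)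

hull⇒≺ : ∀ {n} {x y : Fin n → ℚ} → Decreasing y → InPermutationHull y x → x ≺ y
hull⇒≺ {x = x} {y} y↓ (ws , ws≥0 , Σw≡1 , x≡) = majorization sum≡ bound
  where
  sum≡ : ℚ∑.sum x ≡ ℚ∑.sum y
  sum≡ = begin
    ℚ∑.sum x
      ≡⟨ ℚ∑.sum-cong-≗ x≡ ⟩
    ℚ∑.sum (λ i → combine ws (λ σ → y (σ ⟨$⟩ʳ i)))
      ≡⟨ sumOver-combine ws (λ _ → true) (λ σ → y ∘ (σ ⟨$⟩ʳ_)) ⟩
    combine ws (λ σ → ℚ∑.sum (y ∘ (σ ⟨$⟩ʳ_)))
      ≡⟨ combine-cong ws (λ σ → sum-≡ (permute-≺ {y = y} y↓ σ)) ⟩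
    combine ws (λ _ → ℚ∑.sum y)
      ≡⟨ combine-average ws Σw≡1 _ ⟩
    ℚ∑.sum y ∎
    where open ≡-Reasoning
  bound : ∀ S → sumOver S x ≤ topSum (count S) y
  bound S = begin
    sumOver S x
      ≡⟨ sumOver-cong S x≡ ⟩
    sumOver S (λ i → combine ws (λ σ → y (σ ⟨$⟩ʳ i)))
      ≡⟨ sumOver-combine ws S (λ σ → y ∘ (σ ⟨$⟩ʳ_)) ⟩
    combine ws (λ σ → sumOver S (y ∘ (σ ⟨$⟩ʳ_)))
      ≤⟨ combine-mono ws≥0 (λ σ → sumOver-≤ (permute-≺ {y = y} y↓ σ) S) ⟩
    combine ws (λ _ → topSum (count S) y)
      ≡⟨ combine-average ws Σw≡1 _ ⟩
    topSum (count S) y ∎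
    where open ℚP.≤-Reasoning

hull-nonNeg : ∀ {n} {x y : Fin n → ℚ} → (∀ i → 0ℚ ≤ y i) → InPermutationHull y x → ∀ i → 0ℚ ≤ x i
hull-nonNeg y≥0 (ws , ws≥0 , _ , x≡) i =
  subst₂ _≤_ (combine-zero ws) (sym (x≡ i)) (combine-mono ws≥0 (λ σ → y≥0 (σ ⟨$⟩ʳ i)))

insert-self : ∀ {m n} (i : Fin (suc m)) (j : Fin (suc n)) π → insert i j π ⟨$⟩ʳ i ≡ j
insert-self i j π with i ≟ i
... | yes _   = refl
... | no  i≢i = ⊥-elim (i≢i refl)

hull-insert : ∀ {n} {x z : Fin (suc n) → ℚ} (p : Fin (suc n)) → x p ≡ z zero →
  InPermutationHull (z ∘ suc) (removeAt x p) → InPermutationHull z x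
hull-insert {n} {x} {z} p xp≡z₀ (ws , ws≥0 , Σw≡1 , x≡) =
  map lift ws , AllP.map⁺ ws≥0 , trans (foldr-map _ lift 0ℚ ws) Σw≡1 ,
  λ j → trans (x≡′ (p ≟ j)) (sym (foldr-map _ lift 0ℚ ws))
  where
  lift : ℚ × Permutation′ n → ℚ × Permutation′ (suc n)
  lift (w , τ) = w , insert p zero τ
  x≡′ : ∀ {j} → Dec (p ≡ j) → x j ≡ combine ws (λ τ → z (insert p zero τ ⟨$⟩ʳ j))
  x≡′ (yes refl) = begin
    x p
      ≡⟨ xp≡z₀ ⟩
    z zero
      ≡⟨ combine-average ws Σw≡1 (z zero) ⟨
    combine ws (λ _ → z zero)
      ≡⟨ combine-cong ws (λ τ → cong z (insert-self p zero τ)) ⟨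
    combine ws (λ τ → z (insert p zero τ ⟨$⟩ʳ p)) ∎
    where open ≡-Reasoning
  x≡′ {j} (no p≢j) = begin
    x j
      ≡⟨ removeAt-punchOut x p≢j ⟨
    removeAt x p i
      ≡⟨ x≡ i ⟩
    combine ws (λ τ → z (suc (τ ⟨$⟩ʳ i)))
      ≡⟨ combine-cong ws (λ τ → cong z (insert-punchIn p zero τ i)) ⟨
    combine ws (λ τ → z (insert p zero τ ⟨$⟩ʳ punchIn p i))
      ≡⟨ combine-cong ws (λ τ → cong (λ k → z (insert p zero τ ⟨$⟩ʳ k)) (FinP.punchIn-punchOut p≢j)) ⟩
    combine ws (λ τ → z (insert p zero τ ⟨$⟩ʳ j)) ∎
    where
    open ≡-Reasoning
    i = punchOut p≢j

hull-mix : ∀ {n} {x y : Fin n → ℚ} {t} (σ : Permutation′ n) → 0ℚ ≤ t → t ≤ 1ℚ →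
  InPermutationHull (λ i → mix t (y i) (y (σ ⟨$⟩ʳ i))) x → InPermutationHull y x
hull-mix {n} {x} {y} {t} σ 0≤t t≤1 (ws , ws≥0 , Σw≡1 , x≡) =
  split ws , split-nonNeg ws≥0 , trans (weightSum-split ws) Σw≡1 ,
  λ i → trans (x≡ i) (sym (combine-split ws i))
  where
  split : Combination n → Combination n
  split []             = []
  split ((w , τ) ∷ ws) = (w * t , τ) ∷ (w * (1ℚ - t) , τ ∘ₚ σ) ∷ split ws
  split-nonNeg : ∀ {ws} → NonNegWeights ws → NonNegWeights (split ws)
  split-nonNeg []           = []
  split-nonNeg (w≥0 ∷ ws≥0) = *-nonNeg w≥0 0≤t ∷ *-nonNeg w≥0 (p≤q⇒0≤q-p t≤1) ∷ split-nonNeg ws≥0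
  weightSum-split : ∀ ws → weightSum (split ws) ≡ weightSum ws
  weightSum-split []             = refl
  weightSum-split ((w , τ) ∷ ws) =
    trans (cong (λ s → w * t + (w * (1ℚ - t) + s)) (weightSum-split ws))
    (solve 3 (λ w t s → w :* t :+ (w :* (con 1ℚ :- t) :+ s) := w :+ s) refl w t (weightSum ws))
  combine-split : ∀ ws i → combine (split ws) (λ π → y (π ⟨$⟩ʳ i)) ≡
                           combine ws (λ π → mix t (y (π ⟨$⟩ʳ i)) (y (σ ⟨$⟩ʳ (π ⟨$⟩ʳ i))))
  combine-split []             i = refl
  combine-split ((w , τ) ∷ ws) i =
    trans (cong (λ s → w * t * a + (w * (1ℚ - t) * b + s)) (combine-split ws i))
    (solve 5 (λ w t a b s → w :* t :* a :+ (w :* (con 1ℚ :- t) :* b :+ s) :=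
                            w :* (t :* a :+ (con 1ℚ :- t) :* b) :+ s) refl w t a b _)
    where
    a = y (τ ⟨$⟩ʳ i)
    b = y (σ ⟨$⟩ʳ (τ ⟨$⟩ʳ i))

module ℚExtrema = Data.List.Extrema (DecTotalOrder.totalOrder ℚP.≤-decTotalOrder)

argmax : ∀ {n} → (Fin (suc n) → ℚ) → Fin (suc n)
argmax {n} x = ℚExtrema.argmax x zero (allFin (suc n))

≤-argmax : ∀ {n} (x : Fin (suc n) → ℚ) j → x j ≤ x (argmax x)
≤-argmax {n} x j = All.lookup (ℚExtrema.f[xs]≤f[argmax] {f = x} zero (allFin (suc n))) (∈-allFin j)

first-index-≤ : ∀ {n} {x y : Fin (suc n) → ℚ} → x ≺ y → ∀ p → (∀ j → x j ≤ x p) →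
  ∃ λ k → y k ≤ x p × x p ≤ y zero × (∀ i → toℕ i ℕ.< toℕ k → x p ≤ y i)
first-index-≤ {n} {x} {y} (majorization Σx≡Σy x≤top) p x≤xp =
  let (k , xp≮yk , xp<y) = FinP.¬∀⟶∃¬-smallest (suc n) (λ i → x p < y i) (λ i → x p ℚP.<? y i) not-all
  in  k , ℚP.≮⇒≥ xp≮yk , xp≤y₀ ,
      λ i i<k → ℚP.<⇒≤ (subst (λ j → x p < y j) (inject-fromℕ< i<k) (xp<y (fromℕ< i<k)))
  where
  not-all : ¬ (∀ i → x p < y i)
  not-all xp<y = ℚP.<-irrefl Σx≡Σy (sum-mono-< (λ j → ℚP.≤-<-trans (x≤xp j) (xp<y j)))
  inject-fromℕ< : ∀ {k i : Fin (suc n)} (i<k : toℕ i ℕ.< toℕ k) → inject (fromℕ< i<k) ≡ i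
  inject-fromℕ< i<k = FinP.toℕ-injective (trans (FinP.toℕ-inject _) (FinP.toℕ-fromℕ< i<k))
  ⁅p⁆ : Fin (suc n) → Bool
  ⁅p⁆ = insertAt (λ _ → false) p true
  xp≤y₀ : x p ≤ y zero
  xp≤y₀ = begin
    x p
      ≡⟨ ℚP.+-identityʳ (x p) ⟨
    x p + 0ℚ
      ≡⟨ cong (x p +_) (ℚ∑.sum-replicate-zero n) ⟨
    x p + sumOver (λ _ → false) (removeAt x p)
      ≡⟨ sumOver-insert (λ _ → false) p x ⟨
    sumOver ⁅p⁆ x
      ≤⟨ x≤top ⁅p⁆ ⟩
    topSum (count ⁅p⁆) y
      ≡⟨ cong (λ s → topSum s y) (count-insert (λ _ → false) p) ⟩
    topSum (suc (count {n} (λ _ → false))) y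
      ≡⟨ cong (λ s → topSum (suc s) y) (ℕ∑.sum-replicate-zero n) ⟩
    y zero + topSum 0 (y ∘ suc)
      ≡⟨ cong (y zero +_) (ℚ∑.sum-replicate-zero n) ⟩
    y zero + 0ℚ
      ≡⟨ ℚP.+-identityʳ (y zero) ⟩
    y zero ∎
    where open ℚP.≤-Reasoning

toℕ-punchIn-≤ : ∀ {n} (k : Fin (suc n)) i → toℕ (punchIn k i) ℕ.≤ suc (toℕ i)
toℕ-punchIn-≤ zero    i       = ℕP.≤-refl
toℕ-punchIn-≤ (suc k) zero    = z≤n
toℕ-punchIn-≤ (suc k) (suc i) = s≤s (toℕ-punchIn-≤ k i)

record Pivot {n} (x y : Fin (suc n) → ℚ) : Set where
  field
    p      : Fin (suc n)
    x≤xp   : ∀ j → x j ≤ x p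
    k      : Fin (suc n)
    xp≤y   : ∀ i → toℕ i ℕ.< toℕ k → x p ≤ y i
    t      : ℚ
    0≤t    : 0ℚ ≤ t
    t≤1    : t ≤ 1ℚ
    mix≡xp : mix t (y zero) (y k) ≡ x p

pivot : ∀ {n} {x y : Fin (suc n) → ℚ} → x ≺ y → Pivot x y
pivot {x = x} x≺y =
  let (k , yk≤xp , xp≤y₀ , xp≤y) = first-index-≤ x≺y (argmax x) (≤-argmax x)
      (t , 0≤t , t≤1 , mix≡xp) = between⇒mix yk≤xp xp≤y₀
  in record { p = argmax x ; x≤xp = ≤-argmax x ; k = k ; xp≤y = xp≤y
            ; t = t ; 0≤t = 0≤t ; t≤1 = t≤1 ; mix≡xp = mix≡xp }

module RadoStep {n} {x y : Fin (suc n) → ℚ} (y↓ : Decreasing y) (x≺y : x ≺ y) (piv : Pivot x y) where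

  open Pivot piv

  -- y ∘ (cycle ⟨$⟩ʳ_) is y with y k moved to the front.
  cycle : Permutation′ (suc n)
  cycle = insert zero k id

  z : Fin (suc n) → ℚ
  z i = mix t (y i) (y (cycle ⟨$⟩ʳ i))

  z₀≡xp : z zero ≡ x p
  z₀≡xp = mix≡xp

  z-suc : ∀ i → z (suc i) ≡ mix t (y (suc i)) (y (punchIn k i))
  z-suc i = cong (λ j → mix t (y (suc i)) (y j)) (insert-punchIn zero k id i)

  z∘suc↓ : Decreasing (z ∘ suc)
  z∘suc↓ i j i≤j = subst₂ _≤_ (sym (z-suc j)) (sym (z-suc i))
    (mix-mono 0≤t t≤1 (y↓ (suc i) (suc j) (s≤s i≤j)) (y↓ _ _ (FinP.punchIn-mono-≤ k i j i≤j)))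

  sum-z : ℚ∑.sum z ≡ ℚ∑.sum y
  sum-z = begin
    ℚ∑.sum z                                           ≡⟨ sum-mix t y (y ∘ (cycle ⟨$⟩ʳ_)) ⟩
    mix t (ℚ∑.sum y) (ℚ∑.sum (y ∘ (cycle ⟨$⟩ʳ_)))     ≡⟨ cong (mix t _) (ℚ∑.sum-permute y cycle) ⟨
    mix t (ℚ∑.sum y) (ℚ∑.sum y)                        ≡⟨ mix-idem t _ ⟩
    ℚ∑.sum y                                           ∎
    where open ≡-Reasoning

  topSum-z : ∀ {s} → toℕ k ℕ.≤ s → topSum (suc s) z ≡ topSum (suc s) y
  topSum-z {s} k≤s = begin
    topSum (suc s) z
      ≡⟨ sumOver-mix (prefix (suc s)) t y (y ∘ (cycle ⟨$⟩ʳ_)) ⟩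
    mix t (topSum (suc s) y) (topSum (suc s) (y ∘ (cycle ⟨$⟩ʳ_)))
      ≡⟨ cong (mix t _) topSum-cycle ⟩
    mix t (topSum (suc s) y) (topSum (suc s) y)
      ≡⟨ mix-idem t _ ⟩
    topSum (suc s) y ∎
    where
    open ≡-Reasoning
    topSum-cycle : topSum (suc s) (y ∘ (cycle ⟨$⟩ʳ_)) ≡ topSum (suc s) y
    topSum-cycle = trans
      (cong (y k +_) (sumOver-cong (prefix s) (λ i → cong y (insert-punchIn zero k id i))))
      (sym (topSum-remove y k k≤s))

  xp≤z∘suc : ∀ {s} → s ℕ.< toℕ k → ∀ i → T (prefix s i) → x p ≤ z (suc i)
  xp≤z∘suc s<k i i<s = subst₂ _≤_ (mix-idem t (x p)) (sym (z-suc i)) (mix-mono 0≤t t≤1 xp≤y₁₊ᵢ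
    (ℚP.≤-trans xp≤y₁₊ᵢ (y↓ (punchIn k i) (suc i) (toℕ-punchIn-≤ k i))))
    where
    xp≤y₁₊ᵢ : x p ≤ y (suc i)
    xp≤y₁₊ᵢ = xp≤y (suc i) (ℕP.≤-<-trans (ℕP.<ᵇ⇒< _ _ i<s) s<k)

  extend : InPermutationHull (z ∘ suc) (removeAt x p) → InPermutationHull y x
  extend h = hull-mix {y = y} cycle 0≤t t≤1 (hull-insert {z = z} p (sym z₀≡xp) h)

  x∖p≺z∘suc : removeAt x p ≺ (z ∘ suc)
  x∖p≺z∘suc = majorization sum≡ bound
    where
    sum≡ : ℚ∑.sum (removeAt x p) ≡ ℚ∑.sum (z ∘ suc)
    sum≡ = +-cancelˡ (x p) (begin
      x p + ℚ∑.sum (removeAt x p) ≡⟨ ℚ∑.sum-remove x ⟨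
      ℚ∑.sum x                    ≡⟨ sum-≡ x≺y ⟩
      ℚ∑.sum y                    ≡⟨ sum-z ⟨
      ℚ∑.sum z                    ≡⟨ cong (_+ ℚ∑.sum (z ∘ suc)) z₀≡xp ⟩
      x p + ℚ∑.sum (z ∘ suc)      ∎)
      where open ≡-Reasoning
    bound : ∀ S → sumOver S (removeAt x p) ≤ topSum (count S) (z ∘ suc)
    bound S with toℕ k ℕ.≤? count S
    ... | yes k≤s = +-cancelˡ-≤ (x p) (begin
      x p + sumOver S (removeAt x p)        ≡⟨ sumOver-insert S p x ⟨
      sumOver (insertAt S p true) x         ≤⟨ sumOver-≤ x≺y (insertAt S p true) ⟩
      topSum (count (insertAt S p true)) y  ≡⟨ cong (λ s → topSum s y) (count-insert S p) ⟩
      topSum (suc (count S)) y              ≡⟨ topSum-z k≤s ⟨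
      topSum (suc (count S)) z              ≡⟨ cong (_+ topSum (count S) (z ∘ suc)) z₀≡xp ⟩
      x p + topSum (count S) (z ∘ suc)      ∎)
      where open ℚP.≤-Reasoning
    ... | no k≰s = begin
      sumOver S (removeAt x p)          ≤⟨ sumOver-mono S (λ i _ → x≤xp (punchIn p i)) ⟩
      sumOver S (λ _ → x p)             ≡⟨ sumOver-const S (x p) ⟩
      ι (count S) * x p                 ≡⟨ topSum-const {n} (count S) (x p) (count-≤ S) ⟨
      topSum {n} (count S) (λ _ → x p)
        ≤⟨ sumOver-mono (prefix (count S)) (xp≤z∘suc (ℕP.≰⇒> k≰s)) ⟩
      topSum (count S) (z ∘ suc)        ∎
      where open ℚP.≤-Reasoning

≺⇒hull : ∀ {n} {x y : Fin n → ℚ} → Decreasing y → x ≺ y → InPermutationHull y x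
≺⇒hull {zero}  _  _   = (1ℚ , id) ∷ [] , 0≤1 ∷ [] , ℚP.+-identityʳ 1ℚ , λ ()
≺⇒hull {suc n} y↓ x≺y = extend (≺⇒hull z∘suc↓ x∖p≺z∘suc)
  where open RadoStep y↓ x≺y (pivot x≺y)

θw-word : ∀ {n m} (D : Diagram n m) c → UpClosed (λ r → D r c) →
  ∀ (S : Subset n) k → θw k (word D c S) ≡ (k ℕ.+ count (lookup S)) ℕ.⊓ count (λ r → D r c)
θw-word {zero}  D c _  []         k = sym (ℕP.⊓-zeroʳ (k ℕ.+ 0))
θw-word {suc n} D c up (true ∷ S) k with D zero c
... | false = trans (θw-word (tail D) c (upClosed-tail up) S (suc k))
                    (cong (ℕ._⊓ count (λ r → D (suc r) c)) (sym (ℕP.+-suc k (count (lookup S)))))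
... | true  = trans (cong suc (θw-word (tail D) c (upClosed-tail up) S k))
                    (cong (ℕ._⊓ suc (count (λ r → D (suc r) c))) (sym (ℕP.+-suc k (count (lookup S)))))
θw-word {suc n} D c up (false ∷ S) k with D zero c | up zero
... | false | _ = θw-word (tail D) c (upClosed-tail up) S k
... | true  | column-full with k
...   | suc k = cong suc (θw-word (tail D) c (upClosed-tail up) S k)
...   | zero  = trans (θw-word (tail D) c (upClosed-tail up) S 0)
  (trans (ℕP.m≤n⇒m⊓n≡m ∣S∣≤h) (sym (ℕP.m≤n⇒m⊓n≡m (ℕP.m≤n⇒m≤1+n ∣S∣≤h))))
  where
  ∣S∣≤h : count (lookup S) ℕ.≤ count (λ r → D (suc r) c)
  ∣S∣≤h = subst (_ ℕ.≤_) (sym (count-all _ (λ r → column-full (suc r) z≤n tt))) (count-≤ (lookup S))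

opposite-antimono : ∀ {n} {i j : Fin n} → toℕ i ℕ.≤ toℕ j → toℕ (opposite j) ℕ.≤ toℕ (opposite i)
opposite-antimono {n} {i} {j} i≤j = subst₂ ℕ._≤_ (sym (FinP.opposite-prop j)) (sym (FinP.opposite-prop i))
  (ℕP.∸-monoʳ-≤ n (s≤s i≤j))

module Young {n m} (lam : Fin n → ℕ) (lam↓ : IsPartition lam) (lam≤m : ∀ i → lam i ℕ.≤ m) where

  D : Diagram n m
  D = youngDiagram m lam

  conjugate : Fin m → ℕ
  conjugate c = count (λ i → toℕ c <ᵇ lam i)

  lam≡count : ∀ i → lam i ≡ count {m} (prefix (lam i))
  lam≡count i = sym (trans (count-prefix m (lam i)) (ℕP.m≤n⇒m⊓n≡m (lam≤m i)))

  column-upClosed : ∀ c → UpClosed (λ r → D r c)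
  column-upClosed c r r′ r≤r′ c<λ = ℕP.<⇒<ᵇ
    (ℕP.<-≤-trans (ℕP.<ᵇ⇒< _ _ c<λ) (lam↓ (opposite r′) (opposite r) (opposite-antimono r≤r′)))

  column-height : ∀ c → count (λ r → D r c) ≡ conjugate c
  column-height c = count-permute (λ i → toℕ c <ᵇ lam i) reverse

  conjugate-prefix : ∀ c i → (toℕ c <ᵇ lam i) ≡ prefix (conjugate c) i
  conjugate-prefix c = downClosed⇒prefix λ i j i≤j c<λⱼ →
    ℕP.<⇒<ᵇ (ℕP.<-≤-trans (ℕP.<ᵇ⇒< _ _ c<λⱼ) (lam↓ i j i≤j))

  θcol-young : ∀ c S → θcol D c S ≡ count (lookup S) ℕ.⊓ conjugate c
  θcol-young c S = trans (θw-word D c (column-upClosed c) S 0) (cong (_ ℕ.⊓_) (column-height c))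

  count-column : ∀ s c → count (λ i → prefix s i ∧ (toℕ c <ᵇ lam i)) ≡ s ℕ.⊓ conjugate c
  count-column s c = begin
    count {n} (λ i → prefix s i ∧ (toℕ c <ᵇ lam i))
      ≡⟨ count-cong (λ (i : Fin n) → cong (prefix s i ∧_) (conjugate-prefix c i)) ⟩
    count {n} (λ i → prefix s i ∧ prefix (conjugate c) i)
      ≡⟨ count-cong (λ (i : Fin n) → <ᵇ-⊓ (toℕ i) s (conjugate c)) ⟩
    count {n} (prefix (s ℕ.⊓ conjugate c))
      ≡⟨ count-prefix n _ ⟩
    s ℕ.⊓ conjugate c ℕ.⊓ n
      ≡⟨ ℕP.m≤n⇒m⊓n≡m (ℕP.≤-trans (ℕP.m⊓n≤n s (conjugate c)) (count-≤ _)) ⟩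
    s ℕ.⊓ conjugate c ∎
    where open ≡-Reasoning

  θ-young : ∀ S → θ D S ≡ ℕ∑.sum (λ i → if prefix (count (lookup S)) i then lam i else 0)
  θ-young S = begin
    θ D S
      ≡⟨ Σℕ≗sum (λ c → θcol D c S) ⟩
    ℕ∑.sum (λ (c : Fin m) → θcol D c S)
      ≡⟨ ℕ∑.sum-cong-≗ (λ c → θcol-young c S) ⟩
    ℕ∑.sum (λ (c : Fin m) → s ℕ.⊓ conjugate c)
      ≡⟨ ℕ∑.sum-cong-≗ (count-column s) ⟨
    ℕ∑.sum (λ (c : Fin m) → count (λ i → prefix s i ∧ (toℕ c <ᵇ lam i)))
      ≡⟨ ℕ∑.∑-comm indicator ⟩
    ℕ∑.sum (λ i → count (λ (c : Fin m) → prefix s i ∧ (toℕ c <ᵇ lam i)))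
      ≡⟨ ℕ∑.sum-cong-≗ (λ (i : Fin n) → if-count (prefix s i) i) ⟨
    ℕ∑.sum (λ i → if prefix s i then lam i else 0) ∎
    where
    open ≡-Reasoning
    s = count (lookup S)
    indicator : Fin m → Fin n → ℕ
    indicator c i = if prefix s i ∧ (toℕ c <ᵇ lam i) then 1 else 0
    if-count : ∀ b i → (if b then lam i else 0) ≡ count {m} (λ c → b ∧ (toℕ c <ᵇ lam i))
    if-count true  i = lam≡count i
    if-count false i = sym (ℕ∑.sum-replicate-zero m)

  size-young : size D ≡ ℕ∑.sum lam
  size-young = begin
    size D
      ≡⟨ Σℕ≗sum (λ r → Σℕ (λ c → if D r c then 1 else 0)) ⟩
    ℕ∑.sum (λ r → Σℕ (λ c → if D r c then 1 else 0))
      ≡⟨ ℕ∑.sum-cong-≗ (λ r → Σℕ≗sum (λ c → if D r c then 1 else 0)) ⟩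
    ℕ∑.sum (λ r → count {m} (prefix (lam (opposite r))))
      ≡⟨ ℕ∑.sum-cong-≗ (λ r → lam≡count (opposite r)) ⟨
    ℕ∑.sum (λ r → lam (opposite r))
      ≡⟨ ℕ∑.sum-permute lam reverse ⟨
    ℕ∑.sum lam ∎
    where open ≡-Reasoning

  ι∘lam↓ : Decreasing (ι ∘ lam)
  ι∘lam↓ i j i≤j = ι-mono (lam↓ i j i≤j)

  ι-θ-young : ∀ S → ι (θ D S) ≡ topSum (count (lookup S)) (ι ∘ lam)
  ι-θ-young S = trans (cong ι (θ-young S))
    (trans (ι-sum (λ i → if prefix s i then lam i else 0)) (ℚ∑.sum-cong-≗ (λ i → ι-if (prefix s i) (lam i))))
    where s = count (lookup S)

  ι-size-young : ι (size D) ≡ ℚ∑.sum (ι ∘ lam)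
  ι-size-young = trans (cong ι size-young) (ι-sum lam)

  schubitope⇒≺ : ∀ {α} → InSchubitope D α → α ≺ (ι ∘ lam)
  schubitope⇒≺ {α} (_ , Σα≡size , α≤θ) =
    majorization (trans (sym (Σℚ≗sum α)) (trans Σα≡size ι-size-young)) bound
    where
    bound : ∀ S → sumOver S α ≤ topSum (count S) (ι ∘ lam)
    bound S = subst₂ _≤_
      (trans (Σℚ≗sum (λ i → if lookup S′ i then α i else 0ℚ)) (sumOver-congˡ α (lookup∘tabulate S)))
      (trans (ι-θ-young S′) (cong (λ s → topSum s (ι ∘ lam)) (count-cong (lookup∘tabulate S))))
      (α≤θ S′)
      where S′ = tabulate S

  ≺⇒schubitope : ∀ {α} → (∀ i → 0ℚ ≤ α i) → α ≺ (ι ∘ lam) → InSchubitope D α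
  ≺⇒schubitope {α} α≥0 (majorization Σα≡Σλ α≤top) =
    α≥0 , trans (Σℚ≗sum α) (trans Σα≡Σλ (sym ι-size-young)) ,
    λ S → subst₂ _≤_ (sym (Σℚ≗sum (λ i → if lookup S i then α i else 0ℚ))) (sym (ι-θ-young S))
                     (α≤top (lookup S))

proposition5p23 : (n m : ℕ) (lam : Fin n → ℕ) → IsPartition lam →
    (∀ i → lam i ℕ.≤ m) → (α : Fin n → ℚ) →
    (InSchubitope (youngDiagram m lam) α → InPermutahedron lam α) ×
    (InPermutahedron lam α → InSchubitope (youngDiagram m lam) α)
proposition5p23 n m lam lam↓ lam≤m α =
    (λ α∈S → ≺⇒hull ι∘lam↓ (schubitope⇒≺ α∈S))
  , (λ α∈P → ≺⇒schubitope (hull-nonNeg (ι-nonNeg ∘ lam) α∈P) (hull⇒≺ ι∘lam↓ α∈P))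
  where open Young lam lam↓ lam≤m
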